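{- Let $\mathbf{A}$ be an Epistemic BL-algebra. If $F$ is an epistemic BL-filter of $\mathbf{A}$, then the relation $\equiv_F$ defined by $a\equiv_F b$ iff $a\to b\in F$ and $b\to a\in F$ is a congruence of $\mathbf{A}$ (as an algebra with operations $\vee,\wedge,\ast,\to,\forall,\exists,0,1$), and $F=\{a\in A: a\equiv_F 1\}$. Conversely, if $\equiv$ is a congruence of $\mathbf{A}$, then $F_\equiv=\{a\in A: a\equiv 1\}$ is an epistemic BL-filter, and $a\equiv b$ iff $a\to b\equiv 1$ and $b\to a\equiv 1$. Consequently, $F\mapsto\equiv_F$ is a bijection from the set of epistemic BL-filters of $\mathbf{A}$ onto the set of congruences of $\mathbf{A}$.
   Context: A BL-algebra is an algebra $\langle A,\wedge,\vee,\ast,\to,0,1\rangle$ such that $\langle A,\wedge,\vee,0,1\rangle$ is a bounded lattice (with order $\le$), $\langle A,\ast,1\rangle$ is a commutative monoid, $a\ast b\le c$ iff $a\le b\to c$ for all $a,b,c$, and the identities $a\wedge b=a\ast(a\to b)$ and $(a\to b)\vee(b\to a)=1$ hold. An Epistemic BL-algebra (EBL-algebra) is an algebra $\langle A,\vee,\wedge,\ast,\to,\forall,\exists,0,1\rangle$ whose reduct is a BL-algebra and where $\forall,\exists$ are unary operations satisfying, for all $a,b$: (E$\forall$) $\forall 1=1$; (E$\exists$) $\exists 0=0$; (E1) $\forall a\to\exists a=1$; (E2) $\forall(a\to\forall b)=\exists a\to\forall b$; (E3) $\forall(\forall a\to b)=\forall a\to\forall b$; (E4) $\exists a\to\forall\exists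 a=1$; (E4a) $\forall(a\wedge b)=\forall a\wedge\forall b$; (E4b) $\exists(a\vee b)=\exists a\vee\exists b$; (E5) $\exists(a\ast\exists b)=\exists a\ast\exists b$. An implicative filter of a BL-algebra is a subset $F$ with $1\in F$ such that $x\in F$ and $x\to y\in F$ imply $y\in F$. An epistemic BL-filter of an EBL-algebra is an implicative filter $F$ of its BL-reduct such that whenever $a\to b\in F$, also $\forall a\to\forall b\in F$ and $\exists a\to\exists b\in F$. -}

module Defs where

open import Level using (Level; _⊔_; suc)
open import Data.Product using (_×_; Σ; _,_)
open import Function.Bundles using (_⇔_)
open import Relation.Binary.PropositionalEquality using (_≡_)
open import Relation.Binary.Structures using (IsEquivalence)

record EBLAlgebra (a : Level) : Set (suc a) where
  infixr 5 _→'_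
  infixl 7 _∗_
  infixl 6 _∧_
  infixl 5 _∨_
  infix 4 _≤_
  field
    Carrier : Set a
    _∨_ _∧_ _∗_ _→'_ : Carrier → Carrier → Carrier
    ∀' ∃' : Carrier → Carrier
    𝟘 𝟙 : Carrier

  _≤_ : Carrier → Carrier → Set a
  x ≤ y = x ∧ y ≡ x

  field
    ∧-assoc : ∀ x y z → (x ∧ y) ∧ z ≡ x ∧ (y ∧ z)
    ∨-assoc : ∀ x y z → (x ∨ y) ∨ z ≡ x ∨ (y ∨ z)
    ∧-comm : ∀ x y → x ∧ y ≡ y ∧ x
    ∨-comm : ∀ x y → x ∨ y ≡ y ∨ x
    ∧-absorb-∨ : ∀ x y → x ∧ (x ∨ y) ≡ x
    ∨-absorb-∧ : ∀ x y → x ∨ (x ∧ y) ≡ x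
    𝟘-least : ∀ x → 𝟘 ≤ x
    𝟙-greatest : ∀ x → x ≤ 𝟙
    ∗-assoc : ∀ x y z → (x ∗ y) ∗ z ≡ x ∗ (y ∗ z)
    ∗-comm : ∀ x y → x ∗ y ≡ y ∗ x
    ∗-identityʳ : ∀ x → x ∗ 𝟙 ≡ x
    residuation : ∀ x y z → (x ∗ y ≤ z) ⇔ (x ≤ (y →' z))
    divisibility : ∀ x y → x ∧ y ≡ x ∗ (x →' y)
    prelinearity : ∀ x y → (x →' y) ∨ (y →' x) ≡ 𝟙
    E∀ : ∀' 𝟙 ≡ 𝟙
    E∃ : ∃' 𝟘 ≡ 𝟘
    E1 : ∀ x → ∀' x →' ∃' x ≡ 𝟙
    E2 : ∀ x y → ∀' (x →' ∀' y) ≡ ∃' x →' ∀' y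
    E3 : ∀ x y → ∀' (∀' x →' y) ≡ ∀' x →' ∀' y
    E4 : ∀ x → ∃' x →' ∀' (∃' x) ≡ 𝟙
    E4a : ∀ x y → ∀' (x ∧ y) ≡ ∀' x ∧ ∀' y
    E4b : ∀ x y → ∃' (x ∨ y) ≡ ∃' x ∨ ∃' y
    E5 : ∀ x y → ∃' (x ∗ ∃' y) ≡ ∃' x ∗ ∃' y

module _ {a : Level} (A : EBLAlgebra a) where
  open EBLAlgebra A

  record IsImplicativeFilter {ℓ : Level} (F : Carrier → Set ℓ) : Set (a ⊔ ℓ) where
    field
      contains-𝟙 : F 𝟙
      mp : ∀ {x y} → F x → F (x →' y) → F y

  record IsEpistemicFilter {ℓ : Level} (F : Carrier → Set ℓ) : Set (a ⊔ ℓ) where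
    field
      isImplicativeFilter : IsImplicativeFilter F
      ∀-compat : ∀ {x y} → F (x →' y) → F (∀' x →' ∀' y)
      ∃-compat : ∀ {x y} → F (x →' y) → F (∃' x →' ∃' y)

  -- congruences of the full EBL-algebra (operations ∨ ∧ ∗ → ∀ ∃ 0 1;
  -- constants are trivially preserved by reflexivity)
  record IsCongruence {ℓ : Level} (θ : Carrier → Carrier → Set ℓ) : Set (a ⊔ ℓ) where
    field
      isEquivalence : IsEquivalence θ
      ∨-cong : ∀ {x x' y y'} → θ x x' → θ y y' → θ (x ∨ y) (x' ∨ y')
      ∧-cong : ∀ {x x' y y'} → θ x x' → θ y y' → θ (x ∧ y) (x' ∧ y')
      ∗-cong : ∀ {x x' y y'} → θ x x' → θ y y' → θ (x ∗ y) (x' ∗ y')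
      →-cong : ∀ {x x' y y'} → θ x x' → θ y y' → θ (x →' y) (x' →' y')
      ∀-cong : ∀ {x x'} → θ x x' → θ (∀' x) (∀' x')
      ∃-cong : ∀ {x x'} → θ x x' → θ (∃' x) (∃' x')

  _≡[_]_ : {ℓ : Level} → Carrier → (Carrier → Set ℓ) → Carrier → Set ℓ
  x ≡[ F ] y = F (x →' y) × F (y →' x)

  filterOf : {ℓ : Level} → (Carrier → Carrier → Set ℓ) → Carrier → Set ℓ
  filterOf θ x = θ x 𝟙

-- An implicative filter F is up-closed and closed under ∗, and in a BL-algebra
-- x → x' lies below the residua (x ∗ y → x' ∗ y), (x ∧ y → x' ∧ y),
-- (x ∨ y → x' ∨ y), (x' → y) → (x → y) and (y → x) → (y → x'); hence ≡_F is
-- compatible with the lattice-monoid operations, and the epistemic conditions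
-- on F are exactly compatibility with ∀ and ∃.  Conversely, for a congruence θ,
-- x → y θ 𝟙 gives x = x ∗ 𝟙 θ x ∗ (x → y) = x ∧ y by divisibility, which makes
-- θ determined by the class of 𝟙; monotonicity of ∀ and ∃ (from E4a, E4b) then
-- makes that class an epistemic filter.
module Submission where

open import Defs
open import Level using (Level)
open import Data.Product using (_×_; Σ; _,_)
open import Function.Bundles using (_⇔_; mk⇔; Equivalence)
open import Function.Properties.Equivalence using () renaming (sym to ⇔-sym; trans to ⇔-trans)
open import Relation.Binary.PropositionalEquality
  using (_≡_; refl; sym; trans; cong; cong₂; subst; module ≡-Reasoning)
  renaming (isEquivalence to ≡-isEquivalence)
open import Relation.Binary.Structures using (IsEquivalence)
open import Algebra.Lattice.Bundles using (Lattice)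
open import Algebra.Lattice.Properties.Lattice using (∨-∧-orderTheoreticLattice)
import Relation.Binary.Lattice.Bundles as OrderTheoretic

module BLProperties {a : Level} (A : EBLAlgebra a) where
  open EBLAlgebra A

  lattice : Lattice a a
  lattice = record
    { Carrier = Carrier
    ; _≈_ = _≡_
    ; _∨_ = _∨_
    ; _∧_ = _∧_
    ; isLattice = record
      { isEquivalence = ≡-isEquivalence
      ; ∨-comm = ∨-comm
      ; ∨-assoc = ∨-assoc
      ; ∨-cong = cong₂ _∨_
      ; ∧-comm = ∧-comm
      ; ∧-assoc = ∧-assoc
      ; ∧-cong = cong₂ _∧_
      ; absorptive = ∨-absorb-∧ , ∧-absorb-∨
      }
    }

  -- The library orders a lattice by x ≈ x ∧ y, the symmetric form of _≤_.
  private module Order = OrderTheoretic.Lattice (∨-∧-orderTheoreticLattice lattice)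

  ≤-refl : ∀ {x} → x ≤ x
  ≤-refl = sym Order.refl

  ≤-trans : ∀ {x y z} → x ≤ y → y ≤ z → x ≤ z
  ≤-trans p q = sym (Order.trans (sym p) (sym q))

  ≤-antisym : ∀ {x y} → x ≤ y → y ≤ x → x ≡ y
  ≤-antisym p q = Order.antisym (sym p) (sym q)

  ≤-respˡ-≡ : ∀ {x x' y} → x ≡ x' → x ≤ y → x' ≤ y
  ≤-respˡ-≡ refl p = p

  ≤-respʳ-≡ : ∀ {x y y'} → y ≡ y' → x ≤ y → x ≤ y'
  ≤-respʳ-≡ refl p = p

  x∧y≤x : ∀ x y → x ∧ y ≤ x
  x∧y≤x x y = sym (Order.x∧y≤x x y)

  x∧y≤y : ∀ x y → x ∧ y ≤ y
  x∧y≤y x y = sym (Order.x∧y≤y x y)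

  ∧-greatest : ∀ {x y z} → x ≤ y → x ≤ z → x ≤ y ∧ z
  ∧-greatest p q = sym (Order.∧-greatest (sym p) (sym q))

  x≤x∨y : ∀ x y → x ≤ x ∨ y
  x≤x∨y x y = sym (Order.x≤x∨y x y)

  y≤x∨y : ∀ x y → y ≤ x ∨ y
  y≤x∨y x y = sym (Order.y≤x∨y x y)

  ∨-least : ∀ {x y z} → x ≤ z → y ≤ z → x ∨ y ≤ z
  ∨-least p q = sym (Order.∨-least (sym p) (sym q))

  ≤⇒∨≡ : ∀ {x y} → x ≤ y → x ∨ y ≡ y
  ≤⇒∨≡ {x} {y} p = ≤-antisym (∨-least p ≤-refl) (y≤x∨y x y)

  ∨≡⇒≤ : ∀ {x y} → x ∨ y ≡ y → x ≤ y
  ∨≡⇒≤ {x} p = ≤-respʳ-≡ p (x≤x∨y x _)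

  ∗-identityˡ : ∀ x → 𝟙 ∗ x ≡ x
  ∗-identityˡ x = trans (∗-comm 𝟙 x) (∗-identityʳ x)

  residuate : ∀ {x y z} → x ∗ y ≤ z → x ≤ y →' z
  residuate {x} {y} {z} = Equivalence.to (residuation x y z)

  unresiduate : ∀ {x y z} → x ≤ y →' z → x ∗ y ≤ z
  unresiduate {x} {y} {z} = Equivalence.from (residuation x y z)

  →-identityˡ : ∀ x → 𝟙 →' x ≡ x
  →-identityˡ x = begin
    𝟙 →' x          ≡⟨ ∗-identityˡ (𝟙 →' x) ⟨
    𝟙 ∗ (𝟙 →' x)    ≡⟨ divisibility 𝟙 x ⟨
    𝟙 ∧ x           ≡⟨ ∧-comm 𝟙 x ⟩
    x ∧ 𝟙           ≡⟨ 𝟙-greatest x ⟩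
    x               ∎
    where open ≡-Reasoning

  ≤⇒→≡𝟙 : ∀ {x y} → x ≤ y → x →' y ≡ 𝟙
  ≤⇒→≡𝟙 {x} {y} p =
    ≤-antisym (𝟙-greatest (x →' y)) (residuate (≤-respˡ-≡ (sym (∗-identityˡ x)) p))

  →-refl : ∀ x → x →' x ≡ 𝟙
  →-refl x = ≤⇒→≡𝟙 ≤-refl

  ∗-monoˡ-≤ : ∀ {x y} z → x ≤ y → x ∗ z ≤ y ∗ z
  ∗-monoˡ-≤ z p = unresiduate (≤-trans p (residuate ≤-refl))

  ∗-monoʳ-≤ : ∀ {x y} z → x ≤ y → z ∗ x ≤ z ∗ y
  ∗-monoʳ-≤ {x} {y} z p =
    ≤-respˡ-≡ (∗-comm x z) (≤-respʳ-≡ (∗-comm y z) (∗-monoˡ-≤ z p))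

  modus-ponens : ∀ x y → x ∗ (x →' y) ≤ y
  modus-ponens x y = ≤-respˡ-≡ (∗-comm (x →' y) x) (unresiduate ≤-refl)

  x∗y≤y : ∀ x y → x ∗ y ≤ y
  x∗y≤y x y = ≤-respʳ-≡ (∗-identityˡ y) (∗-monoˡ-≤ y (𝟙-greatest x))

  x∗y≤x : ∀ x y → x ∗ y ≤ x
  x∗y≤x x y = ≤-respˡ-≡ (∗-comm y x) (x∗y≤y y x)

  →-transitive : ∀ x y z → (x →' y) ∗ (y →' z) ≤ x →' z
  →-transitive x y z = residuate (≤-respˡ-≡ (sym reassociate)
    (≤-trans (∗-monoʳ-≤ (y →' z) (modus-ponens x y))
             (≤-respˡ-≡ (∗-comm y (y →' z)) (modus-ponens y z))))
    where
    reassociate : ((x →' y) ∗ (y →' z)) ∗ x ≡ (y →' z) ∗ (x ∗ (x →' y))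
    reassociate = begin
      ((x →' y) ∗ (y →' z)) ∗ x   ≡⟨ cong (_∗ x) (∗-comm (x →' y) (y →' z)) ⟩
      ((y →' z) ∗ (x →' y)) ∗ x   ≡⟨ ∗-assoc (y →' z) (x →' y) x ⟩
      (y →' z) ∗ ((x →' y) ∗ x)   ≡⟨ cong ((y →' z) ∗_) (∗-comm (x →' y) x) ⟩
      (y →' z) ∗ (x ∗ (x →' y))   ∎
      where open ≡-Reasoning

  →-suffixing : ∀ x y z → x →' y ≤ (y →' z) →' (x →' z)
  →-suffixing x y z = residuate (→-transitive x y z)

  →-prefixing : ∀ x y z → y →' z ≤ (x →' y) →' (x →' z)
  →-prefixing x y z = residuate (≤-respˡ-≡ (∗-comm (x →' y) (y →' z)) (→-transitive x y z))

  →-≤-∗-→ : ∀ x x' y → x →' x' ≤ (x ∗ y) →' (x' ∗ y)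
  →-≤-∗-→ x x' y = residuate (≤-respˡ-≡ (sym reassociate) (∗-monoˡ-≤ y (modus-ponens x x')))
    where
    reassociate : (x →' x') ∗ (x ∗ y) ≡ (x ∗ (x →' x')) ∗ y
    reassociate = trans (sym (∗-assoc (x →' x') x y)) (cong (_∗ y) (∗-comm (x →' x') x))

  →-≤-∧-→ : ∀ x x' y → x →' x' ≤ (x ∧ y) →' (x' ∧ y)
  →-≤-∧-→ x x' y = residuate (∧-greatest
    (≤-trans (∗-monoʳ-≤ (x →' x') (x∧y≤x x y))
             (≤-respˡ-≡ (∗-comm x (x →' x')) (modus-ponens x x')))
    (≤-trans (x∗y≤y (x →' x') (x ∧ y)) (x∧y≤y x y)))

  →-≤-∨-→ : ∀ x x' y → x →' x' ≤ (x ∨ y) →' (x' ∨ y)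
  →-≤-∨-→ x x' y = residuate (≤-respˡ-≡ (∗-comm (x ∨ y) (x →' x')) (unresiduate (∨-least
    (residuate (≤-trans (modus-ponens x x') (x≤x∨y x' y)))
    (residuate (≤-trans (x∗y≤x y (x →' x')) (y≤x∨y x' y))))))

  ∃-mono-≤ : ∀ {x y} → x ≤ y → ∃' x ≤ ∃' y
  ∃-mono-≤ {x} {y} p = ∨≡⇒≤ (trans (sym (E4b x y)) (cong ∃' (≤⇒∨≡ p)))

  ∀-mono-≤ : ∀ {x y} → x ≤ y → ∀' x ≤ ∀' y
  ∀-mono-≤ {x} {y} p = ≤-respˡ-≡ (trans (sym (E4a x y)) (cong ∀' p)) (x∧y≤y (∀' x) (∀' y))

module ImplicativeFilterProperties {a ℓ : Level} (A : EBLAlgebra a)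
  {F : EBLAlgebra.Carrier A → Set ℓ} (isFilter : IsImplicativeFilter A F) where
  open EBLAlgebra A
  open BLProperties A
  open IsImplicativeFilter isFilter

  _≈_ : Carrier → Carrier → Set ℓ
  x ≈ y = _≡[_]_ A x F y

  ∈-resp-≡ : ∀ {x y} → x ≡ y → F x → F y
  ∈-resp-≡ = subst F

  up-closed : ∀ {x y} → x ≤ y → F x → F y
  up-closed p Fx = mp Fx (∈-resp-≡ (sym (≤⇒→≡𝟙 p)) contains-𝟙)

  ∗-closed : ∀ {x y} → F x → F y → F (x ∗ y)
  ∗-closed Fx Fy = mp Fy (up-closed (residuate ≤-refl) Fx)

  →-refl-∈ : ∀ x → F (x →' x)
  →-refl-∈ x = ∈-resp-≡ (sym (→-refl x)) contains-𝟙

  →-trans-∈ : ∀ {x y z} → F (x →' y) → F (y →' z) → F (x →' z)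
  →-trans-∈ p q = up-closed (→-transitive _ _ _) (∗-closed p q)

  ≈-isEquivalence : IsEquivalence _≈_
  ≈-isEquivalence = record
    { refl = →-refl-∈ _ , →-refl-∈ _
    ; sym = λ (p , q) → q , p
    ; trans = λ (p , q) (p' , q') → →-trans-∈ p p' , →-trans-∈ q' q
    }

  cong₂-from-congˡ : (_⊙_ : Carrier → Carrier → Carrier) → (∀ x y → x ⊙ y ≡ y ⊙ x) →
    (∀ x x' y → x →' x' ≤ (x ⊙ y) →' (x' ⊙ y)) →
    ∀ {x x' y y'} → x ≈ x' → y ≈ y' → (x ⊙ y) ≈ (x' ⊙ y')
  cong₂-from-congˡ _⊙_ comm congˡ (p , p') (q , q') =
    →-trans-∈ (left p) (right q) , →-trans-∈ (right q') (left p')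
    where
    left : ∀ {x x' y} → F (x →' x') → F ((x ⊙ y) →' (x' ⊙ y))
    left = up-closed (congˡ _ _ _)

    right : ∀ {y y' x} → F (y →' y') → F ((x ⊙ y) →' (x ⊙ y'))
    right {y} {y'} {x} r = ∈-resp-≡ (cong₂ _→'_ (comm y x) (comm y' x)) (left r)

  →-cong-≈ : ∀ {x x' y y'} → x ≈ x' → y ≈ y' → (x →' y) ≈ (x' →' y')
  →-cong-≈ (p , p') (q , q') =
      →-trans-∈ (up-closed (→-suffixing _ _ _) p') (up-closed (→-prefixing _ _ _) q)
    , →-trans-∈ (up-closed (→-suffixing _ _ _) p) (up-closed (→-prefixing _ _ _) q')

  ∈⇔≈𝟙 : ∀ x → F x ⇔ x ≈ 𝟙
  ∈⇔≈𝟙 x = mk⇔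
    (λ Fx → ∈-resp-≡ (sym (≤⇒→≡𝟙 (𝟙-greatest x))) contains-𝟙 , ∈-resp-≡ (sym (→-identityˡ x)) Fx)
    (λ (_ , q) → ∈-resp-≡ (→-identityˡ x) q)

module EpistemicFilterProperties {a ℓ : Level} (A : EBLAlgebra a)
  {F : EBLAlgebra.Carrier A → Set ℓ} (isFilter : IsEpistemicFilter A F) where
  open EBLAlgebra A
  open BLProperties A
  open IsEpistemicFilter isFilter
  open ImplicativeFilterProperties A isImplicativeFilter public using (∈⇔≈𝟙)
  open ImplicativeFilterProperties A isImplicativeFilter

  ≈-isCongruence : IsCongruence A _≈_
  ≈-isCongruence = record
    { isEquivalence = ≈-isEquivalence
    ; ∨-cong = cong₂-from-congˡ _∨_ ∨-comm →-≤-∨-→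
    ; ∧-cong = cong₂-from-congˡ _∧_ ∧-comm →-≤-∧-→
    ; ∗-cong = cong₂-from-congˡ _∗_ ∗-comm →-≤-∗-→
    ; →-cong = →-cong-≈
    ; ∀-cong = λ (p , q) → ∀-compat p , ∀-compat q
    ; ∃-cong = λ (p , q) → ∃-compat p , ∃-compat q
    }

module CongruenceProperties {a ℓ : Level} (A : EBLAlgebra a)
  {θ : EBLAlgebra.Carrier A → EBLAlgebra.Carrier A → Set ℓ} (isCongruence : IsCongruence A θ) where
  open EBLAlgebra A
  open BLProperties A
  open IsCongruence isCongruence
  open IsEquivalence isEquivalence renaming (refl to θ-refl; sym to θ-sym; trans to θ-trans)

  ≡⇒θ : ∀ {x y} → x ≡ y → θ x y
  ≡⇒θ refl = θ-refl

  →θ𝟙⇒θ∧ : ∀ {x y} → θ (x →' y) 𝟙 → θ x (x ∧ y)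
  →θ𝟙⇒θ∧ {x} {y} p =
    θ-trans (≡⇒θ (sym (∗-identityʳ x)))
      (θ-trans (θ-sym (∗-cong θ-refl p)) (≡⇒θ (sym (divisibility x y))))

  θ⇔→θ𝟙 : ∀ x y → θ x y ⇔ (θ (x →' y) 𝟙 × θ (y →' x) 𝟙)
  θ⇔→θ𝟙 x y = mk⇔
    (λ p → θ-trans (→-cong θ-refl (θ-sym p)) (≡⇒θ (→-refl x))
         , θ-trans (→-cong (θ-sym p) θ-refl) (≡⇒θ (→-refl x)))
    (λ (p , q) → θ-trans (→θ𝟙⇒θ∧ p) (θ-trans (≡⇒θ (∧-comm x y)) (θ-sym (→θ𝟙⇒θ∧ q))))

  filterOf-isEpistemicFilter : IsEpistemicFilter A (filterOf A θ)
  filterOf-isEpistemicFilter = record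
    { isImplicativeFilter = record
      { contains-𝟙 = θ-refl
      ; mp = λ {x} {y} x∈ x→y∈ →
          θ-trans (≡⇒θ (sym (→-identityˡ y))) (θ-trans (→-cong (θ-sym x∈) θ-refl) x→y∈)
      }
    ; ∀-compat = λ {x} {y} p → θ-trans (→-cong (∀-cong (→θ𝟙⇒θ∧ p)) θ-refl)
        (≡⇒θ (≤⇒→≡𝟙 (∀-mono-≤ (x∧y≤y x y))))
    ; ∃-compat = λ {x} {y} p → θ-trans (→-cong (∃-cong (→θ𝟙⇒θ∧ p)) θ-refl)
        (≡⇒θ (≤⇒→≡𝟙 (∃-mono-≤ (x∧y≤y x y))))
    }

theorem2 : {a ℓ : Level} (A : EBLAlgebra a) →
    let open EBLAlgebra A in
    -- part 1: filters give congruences, and F = { a : a ≡_F 1 }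
    ((F : Carrier → Set ℓ) → IsEpistemicFilter A F →
      IsCongruence A (λ x y → _≡[_]_ A x F y)
      × (∀ x → F x ⇔ _≡[_]_ A x F 𝟙))
    -- part 2: congruences give filters, and θ coincides with ≡_{F_θ}
    × ((θ : Carrier → Carrier → Set ℓ) → IsCongruence A θ →
      IsEpistemicFilter A (filterOf A θ)
      × (∀ x y → θ x y ⇔ (θ (x →' y) 𝟙 × θ (y →' x) 𝟙)))
    -- part 3: F ↦ ≡_F is a bijection from epistemic filters onto congruences
    -- (sets compared extensionally)
    × ((F G : Carrier → Set ℓ) → IsEpistemicFilter A F → IsEpistemicFilter A G →
        (∀ x y → _≡[_]_ A x F y ⇔ _≡[_]_ A x G y) → ∀ x → F x ⇔ G x)
    × ((θ : Carrier → Carrier → Set ℓ) → IsCongruence A θ →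
        Σ (Carrier → Set ℓ) λ F → IsEpistemicFilter A F
          × (∀ x y → θ x y ⇔ _≡[_]_ A x F y))
theorem2 A =
    (λ F F-filter → ≈-isCongruence F-filter , ∈⇔≈𝟙 F-filter)
  , (λ θ θ-cong → filterOf-isEpistemicFilter θ-cong , θ⇔→θ𝟙 θ-cong)
  , (λ F G F-filter G-filter same x →
       ⇔-trans (∈⇔≈𝟙 F-filter x) (⇔-trans (same x 𝟙) (⇔-sym (∈⇔≈𝟙 G-filter x))))
  , (λ θ θ-cong → filterOf A θ , filterOf-isEpistemicFilter θ-cong , θ⇔→θ𝟙 θ-cong)
  where
  open EBLAlgebra A using (𝟙)
  open EpistemicFilterProperties A using (≈-isCongruence; ∈⇔≈𝟙)
  open CongruenceProperties A using (filterOf-isEpistemicFilter; θ⇔→θ𝟙)
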